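{- Let $X$ be a $(95,40,12,20)$ strongly regular graph and let $K$ be a $4$-clique of $X$ that is not contained in any $5$-clique of $X$. For $i\in\{0,1,2,3\}$ let $X_i$ be the set of vertices of $V(X)\setminus V(K)$ having exactly $i$ neighbours in $K$, and suppose $(|X_0|,|X_1|,|X_2|,|X_3|)=(1,34,54,2)$. Let $x_0$ be the unique vertex of $X_0$. Then $x_0$ is adjacent to both vertices of $X_3$, and $x_0$ has exactly $2$ neighbours in $X_1$ and exactly $36$ neighbours in $X_2$.
   Context: A $k$-regular graph $G$ on $v$ vertices is a $(v,k,\lambda,\mu)$ strongly regular graph if any two distinct adjacent vertices have exactly $\lambda$ common neighbours and any two distinct non-adjacent vertices have exactly $\mu$ common neighbours. -}

module Defs where

open import Data.Nat using (ℕ; _≡ᵇ_)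
open import Data.Bool using (Bool; true; false; _∧_; not)
open import Data.Fin using (Fin)
open import Data.List using (length; filterᵇ; allFin)
open import Relation.Binary.PropositionalEquality using (_≡_; _≢_)
open import Data.Product using (Σ; _×_)
open import Relation.Nullary using (¬_)

record Graph (n : ℕ) : Set where
  field
    adj    : Fin n → Fin n → Bool
    sym    : ∀ x y → adj x y ≡ adj y x
    irrefl : ∀ x → adj x x ≡ false
open Graph public

count : {n : ℕ} → (Fin n → Bool) → ℕ
count {n} P = length (filterᵇ P (allFin n))

commonNbrs : {n : ℕ} → Graph n → Fin n → Fin n → ℕ
commonNbrs G x y = count (λ z → adj G x z ∧ adj G y z)

IsSRG : (v k lam mu : ℕ) → Graph v → Set
IsSRG v k lam mu G =
  (∀ x → count (adj G x) ≡ k) ×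
  (∀ x y → x ≢ y → adj G x y ≡ true → commonNbrs G x y ≡ lam) ×
  (∀ x y → x ≢ y → adj G x y ≡ false → commonNbrs G x y ≡ mu)

IsClique : {n : ℕ} → Graph n → (Fin n → Bool) → Set
IsClique G S = ∀ x y → S x ≡ true → S y ≡ true → x ≢ y → adj G x y ≡ true

IsKClique : {n : ℕ} → Graph n → ℕ → (Fin n → Bool) → Set
IsKClique G m S = IsClique G S × count S ≡ m

_⊆_ : {n : ℕ} → (Fin n → Bool) → (Fin n → Bool) → Set
S ⊆ T = ∀ x → S x ≡ true → T x ≡ true

nbrsIn : {n : ℕ} → Graph n → (Fin n → Bool) → Fin n → ℕ
nbrsIn G S z = count (λ w → S w ∧ adj G z w)

layer : {n : ℕ} → Graph n → (Fin n → Bool) → ℕ → Fin n → Bool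
layer G K i z = not (K z) ∧ (nbrsIn G K z ≡ᵇ i)

-- Fix y ∈ X₃ with x₀ ≁ y, let m be the vertex of K not adjacent to y, and put
-- w := 4·𝟙_K − e_m − 3e_{x₀} + 3e_y.  The adjacency matrix satisfies A² = 20J + 20I − 8A, so
-- h := Aw − 2w − 6·𝟏 has ‖h‖² = 20(Σw)² + 24‖w‖² − 12⟨w,Aw⟩ − 456·Σw + 3420; counting
-- neighbours in K gives Σw = 15, ‖w‖² = 75 and ⟨w,Aw⟩ = 240, hence ‖h‖² = 0.  Thus Aw = 2w + 6,
-- which fails at every vertex z of X₂, where Aw(z) ≡ 2 − [z ∼ m] (mod 3).  So x₀ is adjacent to
-- all of X₃.  Next, x₀ is the only vertex of X₀ and has no neighbour in K, so its 40 neighbours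
-- lie in X₁ ∪ X₂ ∪ X₃; writing bᵢ = |N(x₀) ∩ Xᵢ|, this gives b₁ + b₂ + b₃ = 40, counting pairs
-- (z, k) with x₀ ∼ z ∼ k ∈ K gives b₁ + 2b₂ + 3b₃ = 4μ = 80, and b₃ = |X₃| = 2.

module Submission where

open import Defs renaming (sym to adj-sym)
open import Data.Nat using (ℕ)
open import Data.Bool using (Bool; true; false; _∧_)
open import Data.Fin using (Fin)
open import Data.Product using (Σ; _×_)
open import Relation.Binary.PropositionalEquality using (_≡_)
open import Relation.Nullary using (¬_)

open import Data.Nat as ℕ using (zero; suc; _≡ᵇ_)
open import Data.Nat.Properties using (≡ᵇ⇒≡)
open import Data.Bool using (not; T)
open import Data.Fin using (zero; suc; _≟_)
open import Data.List using (length; filterᵇ; tabulate)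
open import Data.Integer using (ℤ; +_; -[1+_]; _+_; _-_; _*_; -_; _≤_; +≤+)
import Data.Integer.Properties as ℤ
open import Data.Integer.Tactic.RingSolver using (solve-∀)
open import Data.Product using (_,_; ∃; proj₁; proj₂; map₂)
open import Data.Sum using (reduce)
open import Data.Empty using (⊥; ⊥-elim)
open import Function using (_∘_; id)
open import Relation.Binary.PropositionalEquality
  using (refl; sym; trans; cong; cong₂; subst; _≢_; ≢-sym; module ≡-Reasoning)
open import Relation.Nullary using (Dec; does; yes; no; contradiction)
open import Algebra.Properties.Semiring.Sum ℤ.+-*-semiring
  using (sum; sum-cong-≗; ∑-distrib-+; ∑-comm; *-distribˡ-sum; *-distribʳ-sum)

𝟙 : Bool → ℤ
𝟙 true  = + 1
𝟙 false = + 0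

𝟙-∧ : ∀ a b → 𝟙 (a ∧ b) ≡ 𝟙 a * 𝟙 b
𝟙-∧ true  true  = refl
𝟙-∧ true  false = refl
𝟙-∧ false _     = refl

𝟙-idem : ∀ a → 𝟙 a * 𝟙 a ≡ 𝟙 a
𝟙-idem true  = refl
𝟙-idem false = refl

𝟙-nonneg : ∀ a → + 0 ≤ 𝟙 a
𝟙-nonneg true  = +≤+ ℕ.z≤n
𝟙-nonneg false = +≤+ ℕ.z≤n

𝟙*𝟙-nonneg : ∀ a b → + 0 ≤ 𝟙 a * 𝟙 b
𝟙*𝟙-nonneg a b = subst (+ 0 ≤_) (𝟙-∧ a b) (𝟙-nonneg (a ∧ b))

𝟙*𝟙-⊆ : ∀ {a b} → (b ≡ true → a ≡ true) → 𝟙 a * 𝟙 b ≡ 𝟙 b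
𝟙*𝟙-⊆ {a} {false} _   = ℤ.*-zeroʳ (𝟙 a)
𝟙*𝟙-⊆ {a} {true}  b⇒a rewrite b⇒a refl = refl

𝟙*𝟙≡0⇒≡false : ∀ {a b} → 𝟙 a * 𝟙 b ≡ + 0 → b ≡ true → a ≡ false
𝟙*𝟙≡0⇒≡false {false}        _  _  = refl
𝟙*𝟙≡0⇒≡false {true} {true}  () _
𝟙*𝟙≡0⇒≡false {true} {false} _  ()

𝟙*[1-𝟙]≢0 : ∀ {a b} → 𝟙 a * (+ 1 - 𝟙 b) ≢ + 0 → a ≡ true × b ≡ false
𝟙*[1-𝟙]≢0 {true}  {false} _  = refl , refl
𝟙*[1-𝟙]≢0 {true}  {true}  ≢0 = ⊥-elim (≢0 refl)
𝟙*[1-𝟙]≢0 {false} {_}     ≢0 = ⊥-elim (≢0 refl)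

𝟙≢0⇒≡true : ∀ {a} → 𝟙 a ≢ + 0 → a ≡ true
𝟙≢0⇒≡true {true}  _  = refl
𝟙≢0⇒≡true {false} ≢0 = ⊥-elim (≢0 refl)

δ : ∀ {n} → Fin n → Fin n → ℤ
δ i j = 𝟙 (does (i ≟ j))

δ-refl : ∀ {n} (i : Fin n) → δ i i ≡ + 1
δ-refl zero    = refl
δ-refl (suc i) = δ-refl i

δ-≢ : ∀ {n} {i j : Fin n} → i ≢ j → δ i j ≡ + 0
δ-≢ {i = i} {j} i≢j with i ≟ j
... | yes i≡j = ⊥-elim (i≢j i≡j)
... | no _    = refl

sum-scale : ∀ {n} c (f : Fin n → ℤ) → sum (λ i → c * f i) ≡ c * sum f
sum-scale c f = sym (*-distribˡ-sum c f)

sum-scaleʳ : ∀ {n} c (f : Fin n → ℤ) → sum (λ i → f i * c) ≡ sum f * c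
sum-scaleʳ c f = sym (*-distribʳ-sum c f)

-- ∑-distrib-+ restated with ℤ's _+_, so that the summands can be inferred by unification.
sum-+ : ∀ {n} (f g : Fin n → ℤ) → sum (λ i → f i + g i) ≡ sum f + sum g
sum-+ = ∑-distrib-+

sum-linear : ∀ {n} (f : Fin n → ℤ) c g → sum (λ i → f i + c * g i) ≡ sum f + c * sum g
sum-linear f c g = trans (sum-+ f (λ i → c * g i)) (cong (λ s → sum f + s) (sum-scale c g))

sum-+-const : ∀ {n} (f : Fin n → ℤ) c → sum (λ i → f i + c) ≡ sum f + + n * c
sum-+-const {zero}  f c = refl
sum-+-const {suc n} f c =
  trans (cong (λ s → f zero + c + s) (sum-+-const (f ∘ suc) c)) (regroup (f zero) c (sum (f ∘ suc)) (+ n))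
  where
  regroup : ∀ x c s m → x + c + (s + m * c) ≡ x + s + (+ 1 + m) * c
  regroup = solve-∀

sum-δ : ∀ {n} (j : Fin n) (f : Fin n → ℤ) → sum (λ i → δ j i * f i) ≡ f j
sum-δ zero    f = begin
  + 1 * f zero + sum (λ i → + 0 * f (suc i)) ≡⟨ cong₂ _+_ (ℤ.*-identityˡ (f zero)) (sum-scale (+ 0) (f ∘ suc)) ⟩
  f zero + + 0                               ≡⟨ ℤ.+-identityʳ (f zero) ⟩
  f zero                                     ∎
  where open ≡-Reasoning
sum-δ (suc j) f = trans (ℤ.+-identityˡ _) (sum-δ j (f ∘ suc))

sum-nonneg : ∀ {n} {f : Fin n → ℤ} → (∀ i → + 0 ≤ f i) → + 0 ≤ sum f
sum-nonneg {zero}  _   = +≤+ ℕ.z≤n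
sum-nonneg {suc n} f≥0 = ℤ.+-mono-≤ (f≥0 zero) (sum-nonneg (f≥0 ∘ suc))

term≤sum : ∀ {n} {f : Fin n → ℤ} → (∀ i → + 0 ≤ f i) → ∀ j → f j ≤ sum f
term≤sum {suc n} {f} f≥0 zero =
  ℤ.≤-trans (ℤ.≤-reflexive (sym (ℤ.+-identityʳ (f zero)))) (ℤ.+-monoʳ-≤ (f zero) (sum-nonneg (f≥0 ∘ suc)))
term≤sum {suc n} {f} f≥0 (suc j) =
  ℤ.≤-trans (term≤sum (f≥0 ∘ suc) j) (ℤ.≤-trans (ℤ.≤-reflexive (sym (ℤ.+-identityˡ _))) (ℤ.+-monoˡ-≤ _ (f≥0 zero)))

nonneg-sum≡0⇒≡0 : ∀ {n} {f : Fin n → ℤ} → (∀ i → + 0 ≤ f i) → sum f ≡ + 0 → ∀ i → f i ≡ + 0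
nonneg-sum≡0⇒≡0 f≥0 sum≡0 i = ℤ.≤-antisym (ℤ.≤-trans (term≤sum f≥0 i) (ℤ.≤-reflexive sum≡0)) (f≥0 i)

nonneg-sum≡term⇒≡0 : ∀ {n} {f : Fin n → ℤ} → (∀ i → + 0 ≤ f i) → ∀ j → sum f ≡ f j →
                      ∀ i → i ≢ j → f i ≡ + 0
nonneg-sum≡term⇒≡0 {f = f} f≥0 j sum≡fⱼ i i≢j = begin
  f i                  ≡⟨ sym (ℤ.*-identityˡ (f i)) ⟩
  (+ 1 - + 0) * f i    ≡⟨ cong (λ d → (+ 1 - d) * f i) (sym (δ-≢ (i≢j ∘ sym))) ⟩
  (+ 1 - δ j i) * f i  ≡⟨ nonneg-sum≡0⇒≡0 others≥0 sum-others i ⟩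
  + 0                  ∎
  where
  open ≡-Reasoning
  others≥0 : ∀ i → + 0 ≤ (+ 1 - δ j i) * f i
  others≥0 i with j ≟ i
  ... | yes _ = +≤+ ℕ.z≤n
  ... | no  _ = ℤ.≤-trans (f≥0 i) (ℤ.≤-reflexive (sym (ℤ.*-identityˡ (f i))))
  sum-others : sum (λ i → (+ 1 - δ j i) * f i) ≡ + 0
  sum-others = begin
    sum (λ i → (+ 1 - δ j i) * f i)         ≡⟨ sum-cong-≗ (λ i → expand (δ j i) (f i)) ⟩
    sum (λ i → f i + - + 1 * (δ j i * f i)) ≡⟨ sum-linear f (- + 1) (λ i → δ j i * f i) ⟩
    sum f + - + 1 * sum (λ i → δ j i * f i) ≡⟨ cong₂ (λ s t → s + - + 1 * t) sum≡fⱼ (sum-δ j f) ⟩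
    f j + - + 1 * f j                       ≡⟨ cancel (f j) ⟩
    + 0                                     ∎
    where
    expand : ∀ d x → (+ 1 - d) * x ≡ x + - + 1 * (d * x)
    expand = solve-∀
    cancel : ∀ x → x + - + 1 * x ≡ + 0
    cancel = solve-∀

sum-of-≤1≡n⇒≡1 : ∀ {n} {f : Fin n → ℤ} → (∀ i → f i ≤ + 1) → sum f ≡ + n → ∀ i → f i ≡ + 1
sum-of-≤1≡n⇒≡1 {n} {f} f≤1 sum≡n i =
  sym (ℤ.i-j≡0⇒i≡j (+ 1) (f i) (nonneg-sum≡0⇒≡0 (λ i → ℤ.i≤j⇒0≤j-i (f≤1 i)) deficit≡0 i))
  where
  open ≡-Reasoning
  deficit≡0 : sum (λ i → + 1 - f i) ≡ + 0
  deficit≡0 = begin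
    sum (λ i → + 1 - f i)              ≡⟨ sum-cong-≗ (λ i → ℤ.+-comm (+ 1) (- f i)) ⟩
    sum (λ i → - f i + + 1)            ≡⟨ sum-+-const (λ i → - f i) (+ 1) ⟩
    sum (λ i → - f i) + + n * + 1      ≡⟨ cong (λ s → s + + n * + 1) (sum-cong-≗ (λ i → sym (ℤ.-1*i≡-i (f i)))) ⟩
    sum (λ i → - + 1 * f i) + + n * + 1 ≡⟨ cong (λ s → s + + n * + 1) (sum-scale (- + 1) f) ⟩
    - + 1 * sum f + + n * + 1          ≡⟨ cong (λ s → - + 1 * s + + n * + 1) sum≡n ⟩
    - + 1 * + n + + n * + 1            ≡⟨ cancel (+ n) ⟩
    + 0                                ∎
    where
    cancel : ∀ m → - + 1 * m + m * + 1 ≡ + 0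
    cancel = solve-∀

sum≢0⇒∃≢0 : ∀ {n} (f : Fin n → ℤ) → sum f ≢ + 0 → ∃ λ i → f i ≢ + 0
sum≢0⇒∃≢0 {zero}  f sum≢0 = ⊥-elim (sum≢0 refl)
sum≢0⇒∃≢0 {suc n} f sum≢0 with f zero ℤ.≟ + 0
... | no  f₀≢0 = zero , f₀≢0
... | yes f₀≡0 with sum≢0⇒∃≢0 (f ∘ suc) (λ rest≡0 → sum≢0 (cong₂ _+_ f₀≡0 rest≡0))
...   | i , fᵢ≢0 = suc i , fᵢ≢0

length-filter≡sum : ∀ {n} {A : Set} (P : A → Bool) (g : Fin n → A) →
                    + length (filterᵇ P (tabulate g)) ≡ sum (λ i → 𝟙 (P (g i)))
length-filter≡sum {zero}  P g = refl
length-filter≡sum {suc n} P g with P (g zero)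
... | true  = cong (λ s → + 1 + s) (length-filter≡sum P (g ∘ suc))
... | false = trans (length-filter≡sum P (g ∘ suc)) (sym (ℤ.+-identityˡ _))

count≡sum : ∀ {n} (P : Fin n → Bool) → + count P ≡ sum (𝟙 ∘ P)
count≡sum P = length-filter≡sum P id

count≢0⇒∃ : ∀ {n} (P : Fin n → Bool) → count P ≢ 0 → ∃ λ i → P i ≡ true
count≢0⇒∃ P count≢0 =
  map₂ 𝟙≢0⇒≡true (sum≢0⇒∃≢0 (𝟙 ∘ P) (λ sum≡0 → count≢0 (ℤ.+-injective (trans (count≡sum P) sum≡0))))

square-nonneg : ∀ i → + 0 ≤ i * i
square-nonneg (+ zero)  = +≤+ ℕ.z≤n
square-nonneg (+ suc _) = +≤+ ℕ.z≤n
square-nonneg -[1+ _ ]  = +≤+ ℕ.z≤n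

-- Opaque so that, on the concrete 95-vertex graph, comparing two pairings never unfolds
-- them into 95-term sums.
opaque
  ⟨_,_⟩ : ∀ {n} → (Fin n → ℤ) → (Fin n → ℤ) → ℤ
  ⟨ u , v ⟩ = sum (λ i → u i * v i)

  ⟨⟩-comm : ∀ {n} (u v : Fin n → ℤ) → ⟨ u , v ⟩ ≡ ⟨ v , u ⟩
  ⟨⟩-comm u v = sum-cong-≗ (λ i → ℤ.*-comm (u i) (v i))

  ⟨⟩-congʳ : ∀ {n} (f : Fin n → ℤ) {g h} → (∀ i → g i ≡ h i) → ⟨ f , g ⟩ ≡ ⟨ f , h ⟩
  ⟨⟩-congʳ f g≗h = sum-cong-≗ (λ i → cong (f i *_) (g≗h i))

  ⟨⟩-+ʳ : ∀ {n} (f g h : Fin n → ℤ) → ⟨ f , (λ i → g i + h i) ⟩ ≡ ⟨ f , g ⟩ + ⟨ f , h ⟩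
  ⟨⟩-+ʳ f g h = trans (sum-cong-≗ (λ i → ℤ.*-distribˡ-+ (f i) (g i) (h i))) (sum-+ (λ i → f i * g i) (λ i → f i * h i))

  ⟨⟩-scaleʳ : ∀ {n} c (f g : Fin n → ℤ) → ⟨ f , (λ i → c * g i) ⟩ ≡ c * ⟨ f , g ⟩
  ⟨⟩-scaleʳ c f g = trans (sum-cong-≗ (λ i → rearrange c (f i) (g i))) (sum-scale c (λ i → f i * g i))
    where
    rearrange : ∀ c x y → x * (c * y) ≡ c * (x * y)
    rearrange = solve-∀

  ⟨⟩-linearʳ : ∀ {n} (f g : Fin n → ℤ) c h → ⟨ f , (λ i → g i + c * h i) ⟩ ≡ ⟨ f , g ⟩ + c * ⟨ f , h ⟩
  ⟨⟩-linearʳ f g c h = trans (⟨⟩-+ʳ f g (λ i → c * h i)) (cong (λ s → ⟨ f , g ⟩ + s) (⟨⟩-scaleʳ c f h))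

  ⟨-,1⟩≡sum : ∀ {n} (f : Fin n → ℤ) → ⟨ f , (λ _ → + 1) ⟩ ≡ sum f
  ⟨-,1⟩≡sum f = sum-cong-≗ (λ i → ℤ.*-identityʳ (f i))

  ⟨1,-⟩≡sum : ∀ {n} (f : Fin n → ℤ) → ⟨ (λ _ → + 1) , f ⟩ ≡ sum f
  ⟨1,-⟩≡sum f = sum-cong-≗ (λ i → ℤ.*-identityˡ (f i))

  ⟨⟩-scaleˡ : ∀ {n} c (f g : Fin n → ℤ) → ⟨ (λ i → c * f i) , g ⟩ ≡ c * ⟨ f , g ⟩
  ⟨⟩-scaleˡ c f g = trans (sum-cong-≗ (λ i → ℤ.*-assoc c (f i) (g i))) (sum-scale c (λ i → f i * g i))

  ⟨δ,-⟩ : ∀ {n} (j : Fin n) g → ⟨ δ j , g ⟩ ≡ g j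
  ⟨δ,-⟩ = sum-δ

  ⟨+δ,-⟩ : ∀ {n} (f : Fin n → ℤ) c j g → ⟨ (λ i → f i + c * δ j i) , g ⟩ ≡ ⟨ f , g ⟩ + c * g j
  ⟨+δ,-⟩ f c j g = begin
    sum (λ i → (f i + c * δ j i) * g i)        ≡⟨ sum-cong-≗ (λ i → expand c (f i) (δ j i) (g i)) ⟩
    sum (λ i → f i * g i + c * (δ j i * g i))  ≡⟨ sum-linear (λ i → f i * g i) c (λ i → δ j i * g i) ⟩
    ⟨ f , g ⟩ + c * sum (λ i → δ j i * g i)    ≡⟨ cong (λ s → ⟨ f , g ⟩ + c * s) (sum-δ j g) ⟩
    ⟨ f , g ⟩ + c * g j                        ∎
    where
    open ≡-Reasoning
    expand : ∀ c x d y → (x + c * d) * y ≡ x * y + c * (d * y)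
    expand = solve-∀

  ⟨f,f⟩≡0⇒≡0 : ∀ {n} (f : Fin n → ℤ) → ⟨ f , f ⟩ ≡ + 0 → ∀ i → f i ≡ + 0
  ⟨f,f⟩≡0⇒≡0 f ⟨f,f⟩≡0 i =
    reduce (ℤ.i*j≡0⇒i≡0∨j≡0 (f i) (nonneg-sum≡0⇒≡0 (λ i → square-nonneg (f i)) ⟨f,f⟩≡0 i))

  count-∧≡⟨⟩ : ∀ {n} (P Q : Fin n → Bool) → + count (λ i → P i ∧ Q i) ≡ ⟨ 𝟙 ∘ Q , 𝟙 ∘ P ⟩
  count-∧≡⟨⟩ P Q =
    trans (count≡sum (λ i → P i ∧ Q i)) (sum-cong-≗ (λ i → trans (𝟙-∧ (P i) (Q i)) (ℤ.*-comm (𝟙 (P i)) (𝟙 (Q i)))))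

  ⟨𝟙,𝟙⟩≡sum : ∀ {n} {P Q : Fin n → Bool} → P ⊆ Q → ⟨ 𝟙 ∘ Q , 𝟙 ∘ P ⟩ ≡ sum (𝟙 ∘ P)
  ⟨𝟙,𝟙⟩≡sum P⊆Q = sum-cong-≗ (λ i → 𝟙*𝟙-⊆ (P⊆Q i))

module Adjacency {n : ℕ} (G : Graph n) where

  a : Fin n → Fin n → ℤ
  a u v = 𝟙 (adj G u v)

  a-sym : ∀ u v → a u v ≡ a v u
  a-sym u v = cong 𝟙 (adj-sym G u v)

  A : (Fin n → ℤ) → Fin n → ℤ
  A w z = ⟨ a z , w ⟩

  opaque
    unfolding ⟨_,_⟩

    A-selfAdjoint : ∀ u v → ⟨ A u , v ⟩ ≡ ⟨ u , A v ⟩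
    A-selfAdjoint u v = begin
      sum (λ z → A u z * v z)                      ≡⟨ sum-cong-≗ (λ z → ℤ.*-comm (A u z) (v z)) ⟩
      sum (λ z → v z * sum (λ q → a z q * u q))    ≡⟨ sum-cong-≗ (λ z → sym (sum-scale (v z) (λ q → a z q * u q))) ⟩
      sum (λ z → sum (λ q → v z * (a z q * u q)))  ≡⟨ ∑-comm (λ z q → v z * (a z q * u q)) ⟩
      sum (λ q → sum (λ z → v z * (a z q * u q)))  ≡⟨ sum-cong-≗ (λ q → sum-cong-≗ (λ z → swap (v z) (u q) (a-sym z q))) ⟩
      sum (λ q → sum (λ z → u q * (a q z * v z)))  ≡⟨ sum-cong-≗ (λ q → sum-scale (u q) (λ z → a q z * v z)) ⟩
      sum (λ q → u q * A v q)                      ∎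
      where
      open ≡-Reasoning
      rearrange : ∀ x y p → x * (p * y) ≡ y * (p * x)
      rearrange = solve-∀
      swap : ∀ x y {p q} → p ≡ q → x * (p * y) ≡ y * (q * x)
      swap x y {p} refl = rearrange x y p

  module CliqueLayers (K : Fin n → Bool) where

    χ : Fin n → ℤ
    χ = 𝟙 ∘ K

    L : ℕ → Fin n → ℤ
    L i = 𝟙 ∘ layer G K i

    coverage : Fin n → ℤ
    coverage z = χ z + L 0 z + L 1 z + L 2 z + L 3 z

    sum-L : ∀ i → sum (L i) ≡ + count (layer G K i)
    sum-L i = sym (count≡sum (layer G K i))

    layer⇒∉K×nbrsIn : ∀ {i z} → layer G K i z ≡ true → K z ≡ false × nbrsIn G K z ≡ i
    layer⇒∉K×nbrsIn {i} {z} z∈Xᵢ with K z | nbrsIn G K z ≡ᵇ i in nbrs≡ᵇi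
    ... | false | true = refl , ≡ᵇ⇒≡ (nbrsIn G K z) i (subst T (sym nbrs≡ᵇi) _)

    layer⇒∉K : ∀ {i z} → layer G K i z ≡ true → K z ≡ false
    layer⇒∉K = proj₁ ∘ layer⇒∉K×nbrsIn

    layer-unique : ∀ {i j z} → layer G K i z ≡ true → layer G K j z ≡ true → i ≡ j
    layer-unique z∈Xᵢ z∈Xⱼ = trans (sym (proj₂ (layer⇒∉K×nbrsIn z∈Xᵢ))) (proj₂ (layer⇒∉K×nbrsIn z∈Xⱼ))

    layer-≢ : ∀ {i j u v} → layer G K i u ≡ true → layer G K j v ≡ true → i ≢ j → u ≢ v
    layer-≢ u∈Xᵢ v∈Xⱼ i≢j refl = i≢j (layer-unique u∈Xᵢ v∈Xⱼ)

    K-≢-layer : ∀ {i u v} → K u ≡ true → layer G K i v ≡ true → u ≢ v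
    K-≢-layer u∈K v∈Xᵢ refl = contradiction (trans (sym u∈K) (layer⇒∉K v∈Xᵢ)) λ ()

    coverage≤1 : ∀ z → coverage z ≤ + 1
    coverage≤1 z = bound (K z) (nbrsIn G K z)
      where
      bound : ∀ b m → 𝟙 b + 𝟙 (not b ∧ (m ≡ᵇ 0)) + 𝟙 (not b ∧ (m ≡ᵇ 1)) + 𝟙 (not b ∧ (m ≡ᵇ 2))
                      + 𝟙 (not b ∧ (m ≡ᵇ 3)) ≤ + 1
      bound true  _ = ℤ.≤-refl
      bound false 0 = ℤ.≤-refl
      bound false 1 = ℤ.≤-refl
      bound false 2 = ℤ.≤-refl
      bound false 3 = ℤ.≤-refl
      bound false (suc (suc (suc (suc _)))) = +≤+ ℕ.z≤n

    opaque
      unfolding ⟨_,_⟩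

      nbrsIn≡Aχ : ∀ z → + nbrsIn G K z ≡ A χ z
      nbrsIn≡Aχ z = begin
        + nbrsIn G K z                  ≡⟨ count≡sum (λ u → K u ∧ adj G z u) ⟩
        sum (λ u → 𝟙 (K u ∧ adj G z u)) ≡⟨ sum-cong-≗ (λ u → trans (𝟙-∧ (K u) (adj G z u)) (ℤ.*-comm (χ u) (a z u))) ⟩
        A χ z                           ∎
        where open ≡-Reasoning

      layer⇒Aχ : ∀ {i z} → layer G K i z ≡ true → A χ z ≡ + i
      layer⇒Aχ {z = z} z∈Xᵢ = trans (sym (nbrsIn≡Aχ z)) (cong +_ (proj₂ (layer⇒∉K×nbrsIn z∈Xᵢ)))

      Aχ-inside : IsClique G K → ∀ z → K z ≡ true → A χ z ≡ sum χ - + 1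
      Aχ-inside clique z z∈K = begin
        sum (λ u → a z u * χ u)                  ≡⟨ sum-cong-≗ all-but-z ⟩
        sum (λ u → χ u + - + 1 * (δ z u * + 1))  ≡⟨ sum-linear χ (- + 1) (λ u → δ z u * + 1) ⟩
        sum χ + - + 1 * sum (λ u → δ z u * + 1)  ≡⟨ cong (λ s → sum χ + - + 1 * s) (sum-δ z (λ _ → + 1)) ⟩
        sum χ - + 1                              ∎
        where
        open ≡-Reasoning
        all-but-z : ∀ u → a z u * χ u ≡ χ u + - + 1 * (δ z u * + 1)
        all-but-z u with z ≟ u
        ... | yes refl rewrite irrefl G z | z∈K = refl
        ... | no z≢u with K u in u∈K
        ...   | true  rewrite clique z u z∈K u∈K z≢u = refl
        ...   | false = ℤ.*-zeroʳ (a z u)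

      Aχ≡0⇒no-K-nbr : ∀ {z u} → A χ z ≡ + 0 → K u ≡ true → adj G z u ≡ false
      Aχ≡0⇒no-K-nbr {z} {u} Aχz≡0 =
        𝟙*𝟙≡0⇒≡false (nonneg-sum≡0⇒≡0 (λ v → 𝟙*𝟙-nonneg (adj G z v) (K v)) Aχz≡0 u)

      sum-χ-non-nbrs : ∀ z → sum (λ u → χ u * (+ 1 - a z u)) ≡ sum χ - A χ z
      sum-χ-non-nbrs z = begin
        sum (λ u → χ u * (+ 1 - a z u))          ≡⟨ sum-cong-≗ (λ u → expand (χ u) (a z u)) ⟩
        sum (λ u → χ u + - + 1 * (a z u * χ u))  ≡⟨ sum-linear χ (- + 1) (λ u → a z u * χ u) ⟩
        sum χ + - + 1 * A χ z                    ≡⟨ cong (λ s → sum χ + s) (ℤ.-1*i≡-i (A χ z)) ⟩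
        sum χ - A χ z                            ∎
        where
        open ≡-Reasoning
        expand : ∀ c e → c * (+ 1 - e) ≡ c + - + 1 * (e * c)
        expand = solve-∀

      ⟨χ,χ⟩≡sum : ⟨ χ , χ ⟩ ≡ sum χ
      ⟨χ,χ⟩≡sum = sum-cong-≗ (𝟙-idem ∘ K)

      ⟨χ,Aχ⟩-clique : IsClique G K → ⟨ χ , A χ ⟩ ≡ (sum χ - + 1) * sum χ
      ⟨χ,Aχ⟩-clique clique = trans (sum-cong-≗ inside) (sum-scale (sum χ - + 1) χ)
        where
        inside : ∀ z → χ z * A χ z ≡ (sum χ - + 1) * χ z
        inside z with K z in z∈K
        ... | true  = trans (ℤ.*-identityˡ (A χ z)) (trans (Aχ-inside clique z z∈K) (sym (ℤ.*-identityʳ _)))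
        ... | false = sym (ℤ.*-zeroʳ (sum χ - + 1))

    ⟨-,coverage⟩ : ∀ f → ⟨ f , coverage ⟩ ≡ ⟨ f , χ ⟩ + ⟨ f , L 0 ⟩ + ⟨ f , L 1 ⟩ + ⟨ f , L 2 ⟩ + ⟨ f , L 3 ⟩
    ⟨-,coverage⟩ f =
      trans (⟨⟩-+ʳ f (λ z → χ z + L 0 z + L 1 z + L 2 z) (L 3)) (cong (_+ ⟨ f , L 3 ⟩)
      (trans (⟨⟩-+ʳ f (λ z → χ z + L 0 z + L 1 z) (L 2)) (cong (_+ ⟨ f , L 2 ⟩)
      (trans (⟨⟩-+ʳ f (λ z → χ z + L 0 z) (L 1)) (cong (_+ ⟨ f , L 1 ⟩)
      (⟨⟩-+ʳ f χ (L 0)))))))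

    ⟨-,weights⟩ : ∀ f c → ⟨ f , (λ z → c * χ z + L 1 z + + 2 * L 2 z + + 3 * L 3 z) ⟩
                         ≡ c * ⟨ f , χ ⟩ + ⟨ f , L 1 ⟩ + + 2 * ⟨ f , L 2 ⟩ + + 3 * ⟨ f , L 3 ⟩
    ⟨-,weights⟩ f c =
      trans (⟨⟩-linearʳ f (λ z → c * χ z + L 1 z + + 2 * L 2 z) (+ 3) (L 3)) (cong (_+ + 3 * ⟨ f , L 3 ⟩)
      (trans (⟨⟩-linearʳ f (λ z → c * χ z + L 1 z) (+ 2) (L 2)) (cong (_+ + 2 * ⟨ f , L 2 ⟩)
      (trans (⟨⟩-+ʳ f (λ z → c * χ z) (L 1)) (cong (_+ ⟨ f , L 1 ⟩)
      (⟨⟩-scaleʳ c f χ))))))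

  module StronglyRegular (k lam mu : ℕ) (srg : IsSRG n k lam mu G) where

    degree : ∀ u → sum (a u) ≡ + k
    degree u = trans (sym (count≡sum (adj G u))) (cong +_ (proj₁ srg u))

    opaque
      unfolding ⟨_,_⟩

      ⟨a,a⟩≡commonNbrs : ∀ u w → ⟨ a u , a w ⟩ ≡ + commonNbrs G u w
      ⟨a,a⟩≡commonNbrs u w =
        trans (sum-cong-≗ (λ z → sym (𝟙-∧ (adj G u z) (adj G w z)))) (sym (count≡sum (λ z → adj G u z ∧ adj G w z)))

      codegree : ∀ u w → ⟨ a u , a w ⟩ ≡ + mu + (+ k - + mu) * δ u w + (+ lam - + mu) * a u w
      codegree u w with u ≟ w
      ... | yes refl = begin
        ⟨ a u , a u ⟩  ≡⟨ sum-cong-≗ (𝟙-idem ∘ adj G u) ⟩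
        sum (a u)      ≡⟨ degree u ⟩
        + k            ≡⟨ on-diagonal (+ k) (+ lam) (+ mu) ⟩
        + mu + (+ k - + mu) * + 1 + (+ lam - + mu) * + 0
          ≡⟨ cong (λ e → + mu + (+ k - + mu) * + 1 + (+ lam - + mu) * e) (sym (cong 𝟙 (irrefl G u))) ⟩
        + mu + (+ k - + mu) * + 1 + (+ lam - + mu) * a u u  ∎
        where
        open ≡-Reasoning
        on-diagonal : ∀ k l m → k ≡ m + (k - m) * + 1 + (l - m) * + 0
        on-diagonal = solve-∀
      ... | no u≢w with adj G u w in uw
      ...   | true = begin
        ⟨ a u , a w ⟩          ≡⟨ ⟨a,a⟩≡commonNbrs u w ⟩
        + commonNbrs G u w     ≡⟨ cong +_ (proj₁ (proj₂ srg) u w u≢w uw) ⟩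
        + lam                  ≡⟨ adjacent (+ k) (+ lam) (+ mu) ⟩
        + mu + (+ k - + mu) * + 0 + (+ lam - + mu) * + 1  ∎
        where
        open ≡-Reasoning
        adjacent : ∀ k l m → l ≡ m + (k - m) * + 0 + (l - m) * + 1
        adjacent = solve-∀
      ...   | false = begin
        ⟨ a u , a w ⟩          ≡⟨ ⟨a,a⟩≡commonNbrs u w ⟩
        + commonNbrs G u w     ≡⟨ cong +_ (proj₂ (proj₂ srg) u w u≢w uw) ⟩
        + mu                   ≡⟨ non-adjacent (+ k) (+ lam) (+ mu) ⟩
        + mu + (+ k - + mu) * + 0 + (+ lam - + mu) * + 0  ∎
        where
        open ≡-Reasoning
        non-adjacent : ∀ k l m → m ≡ m + (k - m) * + 0 + (l - m) * + 0
        non-adjacent = solve-∀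

      A² : ∀ w z → A (A w) z ≡ + mu * sum w + (+ k - + mu) * w z + (+ lam - + mu) * A w z
      A² w z = begin
        sum (λ y → a z y * sum (λ u → a y u * w u))
          ≡⟨ sum-cong-≗ (λ y → sym (sum-scale (a z y) (λ u → a y u * w u))) ⟩
        sum (λ y → sum (λ u → a z y * (a y u * w u)))
          ≡⟨ ∑-comm (λ y u → a z y * (a y u * w u)) ⟩
        sum (λ u → sum (λ y → a z y * (a y u * w u)))
          ≡⟨ sum-cong-≗ pull-out ⟩
        sum (λ u → ⟨ a z , a u ⟩ * w u)
          ≡⟨ sum-cong-≗ (λ u → cong (_* w u) (codegree z u)) ⟩
        sum (λ u → (+ mu + (+ k - + mu) * δ z u + (+ lam - + mu) * a z u) * w u)
          ≡⟨ sum-cong-≗ (λ u → expand (+ k) (+ lam) (+ mu) (δ z u) (a z u) (w u)) ⟩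
        sum (λ u → + mu * w u + (+ k - + mu) * (δ z u * w u) + (+ lam - + mu) * (a z u * w u))
          ≡⟨ sum-linear _ (+ lam - + mu) (λ u → a z u * w u) ⟩
        sum (λ u → + mu * w u + (+ k - + mu) * (δ z u * w u)) + (+ lam - + mu) * A w z
          ≡⟨ cong (_+ (+ lam - + mu) * A w z) (sum-linear _ (+ k - + mu) (λ u → δ z u * w u)) ⟩
        sum (λ u → + mu * w u) + (+ k - + mu) * sum (λ u → δ z u * w u) + (+ lam - + mu) * A w z
          ≡⟨ cong₂ (λ s t → s + (+ k - + mu) * t + (+ lam - + mu) * A w z) (sum-scale (+ mu) w) (sum-δ z w) ⟩
        + mu * sum w + (+ k - + mu) * w z + (+ lam - + mu) * A w z            ∎
        where
        open ≡-Reasoning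
        pull-out : ∀ u → sum (λ y → a z y * (a y u * w u)) ≡ ⟨ a z , a u ⟩ * w u
        pull-out u = trans (sum-cong-≗ (λ y → reassoc (a z y) (a-sym y u))) (sum-scaleʳ (w u) (λ y → a z y * a u y))
          where
          reassoc : ∀ p {q r} → q ≡ r → p * (q * w u) ≡ p * r * w u
          reassoc p {q} refl = sym (ℤ.*-assoc p q (w u))
        expand : ∀ k l m d e x → (m + (k - m) * d + (l - m) * e) * x ≡ m * x + (k - m) * (d * x) + (l - m) * (e * x)
        expand = solve-∀

      A-ones : ∀ z → A (λ _ → + 1) z ≡ + k
      A-ones z = trans (sum-cong-≗ (λ u → ℤ.*-identityʳ (a z u))) (degree z)

      sum-A : ∀ w → sum (A w) ≡ + k * sum w
      sum-A w = begin
        sum (A w)                  ≡⟨ sum-cong-≗ (λ z → sym (ℤ.*-identityʳ (A w z))) ⟩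
        ⟨ A w , (λ _ → + 1) ⟩      ≡⟨ A-selfAdjoint w (λ _ → + 1) ⟩
        ⟨ w , A (λ _ → + 1) ⟩      ≡⟨ sum-cong-≗ (λ z → cong (w z *_) (A-ones z)) ⟩
        sum (λ z → w z * + k)      ≡⟨ sum-scaleʳ (+ k) w ⟩
        sum w * + k                ≡⟨ ℤ.*-comm (sum w) (+ k) ⟩
        + k * sum w                ∎
        where open ≡-Reasoning

      normSq-A : ∀ w → ⟨ A w , A w ⟩ ≡ + mu * (sum w * sum w) + (+ k - + mu) * ⟨ w , w ⟩ + (+ lam - + mu) * ⟨ w , A w ⟩
      normSq-A w = begin
        ⟨ A w , A w ⟩                ≡⟨ A-selfAdjoint w (A w) ⟩
        sum (λ z → w z * A (A w) z)  ≡⟨ sum-cong-≗ (λ z → cong (w z *_) (A² w z)) ⟩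
        sum (λ z → w z * (+ mu * sum w + (+ k - + mu) * w z + (+ lam - + mu) * A w z))
          ≡⟨ sum-cong-≗ (λ z → expand (+ mu * sum w) (+ k - + mu) (+ lam - + mu) (w z) (A w z)) ⟩
        sum (λ z → + mu * sum w * w z + (+ k - + mu) * (w z * w z) + (+ lam - + mu) * (w z * A w z))
          ≡⟨ sum-linear _ (+ lam - + mu) (λ z → w z * A w z) ⟩
        sum (λ z → + mu * sum w * w z + (+ k - + mu) * (w z * w z)) + (+ lam - + mu) * ⟨ w , A w ⟩
          ≡⟨ cong (_+ (+ lam - + mu) * ⟨ w , A w ⟩) (sum-linear _ (+ k - + mu) (λ z → w z * w z)) ⟩
        sum (λ z → + mu * sum w * w z) + (+ k - + mu) * ⟨ w , w ⟩ + (+ lam - + mu) * ⟨ w , A w ⟩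
          ≡⟨ cong (λ s → s + (+ k - + mu) * ⟨ w , w ⟩ + (+ lam - + mu) * ⟨ w , A w ⟩)
                  (trans (sum-scale (+ mu * sum w) w) (ℤ.*-assoc (+ mu) (sum w) (sum w))) ⟩
        + mu * (sum w * sum w) + (+ k - + mu) * ⟨ w , w ⟩ + (+ lam - + mu) * ⟨ w , A w ⟩ ∎
        where
        open ≡-Reasoning
        expand : ∀ c p q x y → x * (c + p * x + q * y) ≡ c * x + p * (x * x) + q * (x * y)
        expand = solve-∀

      normSq-affine : ∀ w α β →
        ⟨ (λ z → A w z + α * w z + β) , (λ z → A w z + α * w z + β) ⟩ ≡
          + mu * (sum w * sum w) + (+ k - + mu + α * α) * ⟨ w , w ⟩ + (+ lam - + mu + + 2 * α) * ⟨ w , A w ⟩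
          + + 2 * β * (+ k + α) * sum w + + n * (β * β)
      normSq-affine w α β = begin
        sum (λ z → (A w z + α * w z + β) * (A w z + α * w z + β))
          ≡⟨ sum-cong-≗ (λ z → expand α β (A w z) (w z)) ⟩
        sum (λ z → A w z * A w z + + 2 * α * (w z * A w z) + α * α * (w z * w z) + + 2 * β * A w z + + 2 * α * β * w z + β * β)
          ≡⟨ distribute ⟩
        ⟨ A w , A w ⟩ + + 2 * α * ⟨ w , A w ⟩ + α * α * ⟨ w , w ⟩ + + 2 * β * sum (A w) + + 2 * α * β * sum w + + n * (β * β)
          ≡⟨ cong₂ (λ s t → s + + 2 * α * ⟨ w , A w ⟩ + α * α * ⟨ w , w ⟩ + + 2 * β * t
                                + + 2 * α * β * sum w + + n * (β * β))
                   (normSq-A w) (sum-A w) ⟩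
        + mu * (sum w * sum w) + (+ k - + mu) * ⟨ w , w ⟩ + (+ lam - + mu) * ⟨ w , A w ⟩
          + + 2 * α * ⟨ w , A w ⟩ + α * α * ⟨ w , w ⟩ + + 2 * β * (+ k * sum w) + + 2 * α * β * sum w + + n * (β * β)
          ≡⟨ collect α β (+ k) (+ lam) (+ mu) (+ n) (sum w) ⟨ w , w ⟩ ⟨ w , A w ⟩ ⟩
        + mu * (sum w * sum w) + (+ k - + mu + α * α) * ⟨ w , w ⟩ + (+ lam - + mu + + 2 * α) * ⟨ w , A w ⟩
          + + 2 * β * (+ k + α) * sum w + + n * (β * β) ∎
        where
        open ≡-Reasoning
        expand : ∀ α β p x → (p + α * x + β) * (p + α * x + β) ≡
                             p * p + + 2 * α * (x * p) + α * α * (x * x) + + 2 * β * p + + 2 * α * β * x + β * β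
        expand = solve-∀
        distribute :
          sum (λ z → A w z * A w z + + 2 * α * (w z * A w z) + α * α * (w z * w z) + + 2 * β * A w z + + 2 * α * β * w z + β * β)
          ≡ ⟨ A w , A w ⟩ + + 2 * α * ⟨ w , A w ⟩ + α * α * ⟨ w , w ⟩ + + 2 * β * sum (A w)
            + + 2 * α * β * sum w + + n * (β * β)
        distribute =
          trans (sum-+-const {n} _ (β * β)) (cong (_+ + n * (β * β))
            (trans (sum-linear _ (+ 2 * α * β) w) (cong (_+ + 2 * α * β * sum w)
            (trans (sum-linear _ (+ 2 * β) (A w)) (cong (_+ + 2 * β * sum (A w))
            (trans (sum-linear _ (α * α) (λ z → w z * w z)) (cong (_+ α * α * ⟨ w , w ⟩)
            (sum-linear _ (+ 2 * α) (λ z → w z * A w z)))))))))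
        collect : ∀ α β k l m n s q r →
          m * (s * s) + (k - m) * q + (l - m) * r + + 2 * α * r + α * α * q + + 2 * β * (k * s) + + 2 * α * β * s + n * (β * β)
          ≡ m * (s * s) + (k - m + α * α) * q + (l - m + + 2 * α) * r + + 2 * β * (k + α) * s + n * (β * β)
        collect = solve-∀

module FourClique (X : Graph 95) (srg : IsSRG 95 40 12 20 X) (K : Fin 95 → Bool) (clique : IsKClique X 4 K) where

  open Adjacency X
  open StronglyRegular 40 12 20 srg
  open CliqueLayers K

  sum-χ : sum χ ≡ + 4
  sum-χ = trans (sym (count≡sum K)) (cong +_ (proj₂ clique))

  Aχ≡3 : ∀ {z} → K z ≡ true → A χ z ≡ + 3
  Aχ≡3 z∈K = trans (Aχ-inside (proj₁ clique) _ z∈K) (cong (_- + 1) sum-χ)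

  ⟨χ,χ⟩ : ⟨ χ , χ ⟩ ≡ + 4
  ⟨χ,χ⟩ = trans ⟨χ,χ⟩≡sum sum-χ

  ⟨χ,Aχ⟩ : ⟨ χ , A χ ⟩ ≡ + 12
  ⟨χ,Aχ⟩ = trans (⟨χ,Aχ⟩-clique (proj₁ clique)) (cong (λ s → (s - + 1) * s) sum-χ)

  Aχ≡weights : ∀ z → coverage z ≡ + 1 → A χ z ≡ + 3 * χ z + L 1 z + + 2 * L 2 z + + 3 * L 3 z
  Aχ≡weights z covered =
    trans (sym (nbrsIn≡Aχ z))
          (weights (K z) (nbrsIn X K z) (λ z∈K → ℤ.+-injective (trans (nbrsIn≡Aχ z) (Aχ≡3 z∈K))) covered)
    where
    weights : ∀ b m → (b ≡ true → m ≡ 3) →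
              𝟙 b + 𝟙 (not b ∧ (m ≡ᵇ 0)) + 𝟙 (not b ∧ (m ≡ᵇ 1)) + 𝟙 (not b ∧ (m ≡ᵇ 2))
                  + 𝟙 (not b ∧ (m ≡ᵇ 3)) ≡ + 1 →
              + m ≡ + 3 * 𝟙 b + 𝟙 (not b ∧ (m ≡ᵇ 1)) + + 2 * 𝟙 (not b ∧ (m ≡ᵇ 2)) + + 3 * 𝟙 (not b ∧ (m ≡ᵇ 3))
    weights true  m m≡3 _ = cong +_ (m≡3 refl)
    weights false 0 _ _ = refl
    weights false 1 _ _ = refl
    weights false 2 _ _ = refl
    weights false 3 _ _ = refl
    weights false (suc (suc (suc (suc _)))) _ ()

  module NonAdjacentX₀X₃ {x y : Fin 95} (x∈X₀ : layer X K 0 x ≡ true) (y∈X₃ : layer X K 3 y ≡ true)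
                         (x≁y : adj X x y ≡ false) where

    K-non-nbr-of-y : ∃ λ m → K m ≡ true × adj X y m ≡ false
    K-non-nbr-of-y =
      map₂ 𝟙*[1-𝟙]≢0 (sum≢0⇒∃≢0 (λ u → χ u * (+ 1 - a y u)) (λ sum≡0 → contradiction (begin
        + 1                              ≡⟨ cong₂ _-_ sum-χ (layer⇒Aχ y∈X₃) ⟨
        sum χ - A χ y                    ≡⟨ sum-χ-non-nbrs y ⟨
        sum (λ u → χ u * (+ 1 - a y u))  ≡⟨ sum≡0 ⟩
        + 0                              ∎) λ ()))
      where open ≡-Reasoning

    m : Fin 95
    m = proj₁ K-non-nbr-of-y

    m∈K : K m ≡ true
    m∈K = proj₁ (proj₂ K-non-nbr-of-y)

    y≁m : adj X y m ≡ false
    y≁m = proj₂ (proj₂ K-non-nbr-of-y)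

    x∉K : K x ≡ false
    x∉K = layer⇒∉K x∈X₀

    y∉K : K y ≡ false
    y∉K = layer⇒∉K y∈X₃

    x≁m : adj X x m ≡ false
    x≁m = Aχ≡0⇒no-K-nbr (layer⇒Aχ x∈X₀) m∈K

    x≢y : x ≢ y
    x≢y = layer-≢ x∈X₀ y∈X₃ λ ()

    a-sym≡0 : ∀ {u z} → adj X u z ≡ false → a z u ≡ + 0
    a-sym≡0 {u} {z} u≁z = cong 𝟙 (trans (adj-sym X z u) u≁z)

    lincomb : ℤ → ℤ → ℤ → ℤ → ℤ
    lincomb s p q r = + 4 * s + - + 1 * p + - + 3 * q + + 3 * r

    lincomb-cong : ∀ {s s′ p p′ q q′ r r′} → s ≡ s′ → p ≡ p′ → q ≡ q′ → r ≡ r′ →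
                   lincomb s p q r ≡ lincomb s′ p′ q′ r′
    lincomb-cong refl refl refl refl = refl

    w : Fin 95 → ℤ
    w u = lincomb (χ u) (δ m u) (δ x u) (δ y u)

    ⟨w,-⟩ : ∀ g → ⟨ w , g ⟩ ≡ lincomb ⟨ χ , g ⟩ (g m) (g x) (g y)
    ⟨w,-⟩ g = begin
      ⟨ w , g ⟩
        ≡⟨ ⟨+δ,-⟩ (λ u → + 4 * χ u + - + 1 * δ m u + - + 3 * δ x u) (+ 3) y g ⟩
      ⟨ (λ u → + 4 * χ u + - + 1 * δ m u + - + 3 * δ x u) , g ⟩ + + 3 * g y
        ≡⟨ cong (_+ + 3 * g y) (⟨+δ,-⟩ (λ u → + 4 * χ u + - + 1 * δ m u) (- + 3) x g) ⟩
      ⟨ (λ u → + 4 * χ u + - + 1 * δ m u) , g ⟩ + - + 3 * g x + + 3 * g y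
        ≡⟨ cong (λ s → s + - + 3 * g x + + 3 * g y) (⟨+δ,-⟩ (λ u → + 4 * χ u) (- + 1) m g) ⟩
      ⟨ (λ u → + 4 * χ u) , g ⟩ + - + 1 * g m + - + 3 * g x + + 3 * g y
        ≡⟨ cong (λ s → s + - + 1 * g m + - + 3 * g x + + 3 * g y) (⟨⟩-scaleˡ (+ 4) χ g) ⟩
      lincomb ⟨ χ , g ⟩ (g m) (g x) (g y) ∎
      where open ≡-Reasoning

    w-m : w m ≡ + 3
    w-m = lincomb-cong (cong 𝟙 m∈K) (δ-refl m)
                       (δ-≢ (≢-sym (K-≢-layer m∈K x∈X₀))) (δ-≢ (≢-sym (K-≢-layer m∈K y∈X₃)))

    w-x : w x ≡ - + 3
    w-x = lincomb-cong (cong 𝟙 x∉K) (δ-≢ (K-≢-layer m∈K x∈X₀)) (δ-refl x) (δ-≢ (≢-sym x≢y))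

    w-y : w y ≡ + 3
    w-y = lincomb-cong (cong 𝟙 y∉K) (δ-≢ (K-≢-layer m∈K y∈X₃)) (δ-≢ x≢y) (δ-refl y)

    sum-w : sum w ≡ + 15
    sum-w = begin
      sum w                                          ≡⟨ ⟨-,1⟩≡sum w ⟨
      ⟨ w , (λ _ → + 1) ⟩                            ≡⟨ ⟨w,-⟩ (λ _ → + 1) ⟩
      lincomb ⟨ χ , (λ _ → + 1) ⟩ (+ 1) (+ 1) (+ 1)
        ≡⟨ cong (λ s → lincomb s (+ 1) (+ 1) (+ 1)) (trans (⟨-,1⟩≡sum χ) sum-χ) ⟩
      lincomb (+ 4) (+ 1) (+ 1) (+ 1)                ≡⟨⟩
      + 15                                           ∎
      where open ≡-Reasoning

    ⟨w,w⟩ : ⟨ w , w ⟩ ≡ + 75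
    ⟨w,w⟩ = trans (⟨w,-⟩ w) (lincomb-cong ⟨χ,w⟩ w-m w-x w-y)
      where
      ⟨χ,w⟩ : ⟨ χ , w ⟩ ≡ + 15
      ⟨χ,w⟩ = trans (⟨⟩-comm χ w)
                    (trans (⟨w,-⟩ χ) (lincomb-cong ⟨χ,χ⟩ (cong 𝟙 m∈K) (cong 𝟙 x∉K) (cong 𝟙 y∉K)))

    Aw : ∀ z → A w z ≡ lincomb (A χ z) (a z m) (a z x) (a z y)
    Aw z = trans (⟨⟩-comm (a z) w) (trans (⟨w,-⟩ (a z)) (lincomb-cong (⟨⟩-comm χ (a z)) refl refl refl))

    ⟨w,Aw⟩ : ⟨ w , A w ⟩ ≡ + 240
    ⟨w,Aw⟩ = trans (⟨w,-⟩ (A w)) (lincomb-cong ⟨χ,Aw⟩ Aw-m Aw-x Aw-y)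
      where
      ⟨χ,Aw⟩ : ⟨ χ , A w ⟩ ≡ + 54
      ⟨χ,Aw⟩ = begin
        ⟨ χ , A w ⟩                                  ≡⟨ A-selfAdjoint χ w ⟨
        ⟨ A χ , w ⟩                                  ≡⟨ ⟨⟩-comm (A χ) w ⟩
        ⟨ w , A χ ⟩                                  ≡⟨ ⟨w,-⟩ (A χ) ⟩
        lincomb ⟨ χ , A χ ⟩ (A χ m) (A χ x) (A χ y)
          ≡⟨ lincomb-cong ⟨χ,Aχ⟩ (Aχ≡3 m∈K) (layer⇒Aχ x∈X₀) (layer⇒Aχ y∈X₃) ⟩
        + 54                                         ∎
        where open ≡-Reasoning
      Aw-m : A w m ≡ + 12
      Aw-m = trans (Aw m) (lincomb-cong (Aχ≡3 m∈K) (cong 𝟙 (irrefl X m)) (a-sym≡0 x≁m) (a-sym≡0 y≁m))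
      Aw-x : A w x ≡ + 0
      Aw-x = trans (Aw x) (lincomb-cong (layer⇒Aχ x∈X₀) (cong 𝟙 x≁m) (cong 𝟙 (irrefl X x)) (cong 𝟙 x≁y))
      Aw-y : A w y ≡ + 12
      Aw-y = trans (Aw y) (lincomb-cong (layer⇒Aχ y∈X₃) (cong 𝟙 y≁m) (a-sym≡0 x≁y) (cong 𝟙 (irrefl X y)))

    h : Fin 95 → ℤ
    h z = A w z + - + 2 * w z + - + 6

    h≡0 : ∀ z → h z ≡ + 0
    h≡0 = ⟨f,f⟩≡0⇒≡0 h (trans (normSq-affine w (- + 2) (- + 6)) (vanishes sum-w ⟨w,w⟩ ⟨w,Aw⟩))
      where
      vanishes : ∀ {s q r} → s ≡ + 15 → q ≡ + 75 → r ≡ + 240 →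
        + 20 * (s * s) + (+ 40 - + 20 + - + 2 * - + 2) * q + (+ 12 - + 20 + + 2 * - + 2) * r
        + + 2 * - + 6 * (+ 40 + - + 2) * s + + 95 * (- + 6 * - + 6) ≡ + 0
      vanishes refl refl refl = refl

    X₂-empty : ∀ {z} → layer X K 2 z ≡ true → ⊥
    X₂-empty {z} z∈X₂ = no-root (adj X z m) (adj X z x) (adj X z y) (begin
      lincomb (+ 2) (a z m) (a z x) (a z y) + - + 2 * + 0 + - + 6  ≡⟨ cong₂ (λ s t → s + - + 2 * t + - + 6) Aw-z w-z ⟨
      h z                                                         ≡⟨ h≡0 z ⟩
      + 0                                                         ∎)
      where
      open ≡-Reasoning
      Aw-z : A w z ≡ lincomb (+ 2) (a z m) (a z x) (a z y)
      Aw-z = trans (Aw z) (lincomb-cong (layer⇒Aχ z∈X₂) refl refl refl)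
      w-z : w z ≡ + 0
      w-z = lincomb-cong (cong 𝟙 (layer⇒∉K z∈X₂)) (δ-≢ (K-≢-layer m∈K z∈X₂))
                         (δ-≢ (layer-≢ x∈X₀ z∈X₂ λ ())) (δ-≢ (layer-≢ y∈X₃ z∈X₂ λ ()))
      -- modulo 3 the left-hand side is 2 − 𝟙 p
      no-root : ∀ p q r → lincomb (+ 2) (𝟙 p) (𝟙 q) (𝟙 r) + - + 2 * + 0 + - + 6 ≢ + 0
      no-root true  true  true  ()
      no-root true  true  false ()
      no-root true  false true  ()
      no-root true  false false ()
      no-root false true  true  ()
      no-root false true  false ()
      no-root false false true  ()
      no-root false false false ()

  X₃⊆N[x₀] : ∀ {x} → layer X K 0 x ≡ true → count (layer X K 2) ≡ 54 → layer X K 3 ⊆ adj X x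
  X₃⊆N[x₀] {x} x∈X₀ |X₂|≡54 y y∈X₃ = by-adjacency (adj X x y) refl
    where
    X₂-inhabited : ∃ λ z → layer X K 2 z ≡ true
    X₂-inhabited = count≢0⇒∃ (layer X K 2) (λ |X₂|≡0 → contradiction (trans (sym |X₂|≡54) |X₂|≡0) λ ())
    by-adjacency : ∀ b → adj X x y ≡ b → adj X x y ≡ true
    by-adjacency true  x∼y = x∼y
    by-adjacency false x≁y = ⊥-elim (NonAdjacentX₀X₃.X₂-empty x∈X₀ y∈X₃ x≁y (proj₂ X₂-inhabited))

  module NbrsOfX₀ {x : Fin 95} (x∈X₀ : layer X K 0 x ≡ true)
                  (|X₀|≡1 : count (layer X K 0) ≡ 1) (|X₁|≡34 : count (layer X K 1) ≡ 34)
                  (|X₂|≡54 : count (layer X K 2) ≡ 54) (|X₃|≡2 : count (layer X K 3) ≡ 2) where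

    covered : ∀ z → coverage z ≡ + 1
    covered = sum-of-≤1≡n⇒≡1 coverage≤1 (begin
      sum coverage                                             ≡⟨ ⟨1,-⟩≡sum coverage ⟨
      ⟨ 𝟏 , coverage ⟩                                         ≡⟨ ⟨-,coverage⟩ 𝟏 ⟩
      ⟨ 𝟏 , χ ⟩ + ⟨ 𝟏 , L 0 ⟩ + ⟨ 𝟏 , L 1 ⟩ + ⟨ 𝟏 , L 2 ⟩ + ⟨ 𝟏 , L 3 ⟩
        ≡⟨ sizes (trans (⟨1,-⟩≡sum χ) sum-χ)
                 (|Xᵢ| 0 |X₀|≡1) (|Xᵢ| 1 |X₁|≡34) (|Xᵢ| 2 |X₂|≡54) (|Xᵢ| 3 |X₃|≡2) ⟩
      + 95                                                     ∎)
      where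
      open ≡-Reasoning
      𝟏 : Fin 95 → ℤ
      𝟏 _ = + 1
      |Xᵢ| : ∀ i {c} → count (layer X K i) ≡ c → ⟨ 𝟏 , L i ⟩ ≡ + c
      |Xᵢ| i |Xᵢ|≡c = trans (⟨1,-⟩≡sum (L i)) (trans (sum-L i) (cong +_ |Xᵢ|≡c))
      sizes : ∀ {s t u v w} → s ≡ + 4 → t ≡ + 1 → u ≡ + 34 → v ≡ + 54 → w ≡ + 2 → s + t + u + v + w ≡ + 95
      sizes refl refl refl refl refl = refl

    L₀≡δₓ : ∀ z → L 0 z ≡ δ x z
    L₀≡δₓ z = by-equality (x ≟ z)
      where
      sum-L₀≡L₀x : sum (L 0) ≡ L 0 x
      sum-L₀≡L₀x = trans (sum-L 0) (trans (cong +_ |X₀|≡1) (sym (cong 𝟙 x∈X₀)))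
      by-equality : (x≟z : Dec (x ≡ z)) → L 0 z ≡ 𝟙 (does x≟z)
      by-equality (yes refl) = cong 𝟙 x∈X₀
      by-equality (no  x≢z)  = nonneg-sum≡term⇒≡0 (𝟙-nonneg ∘ layer X K 0) x sum-L₀≡L₀x z (≢-sym x≢z)

    b : ℕ → ℤ
    b i = ⟨ a x , L i ⟩

    b₁+b₂+b₃≡40 : b 1 + b 2 + b 3 ≡ + 40
    b₁+b₂+b₃≡40 = begin
      b 1 + b 2 + b 3                                   ≡⟨ drop-zeros (layer⇒Aχ x∈X₀) no-X₀-nbr ⟨
      ⟨ a x , χ ⟩ + ⟨ a x , L 0 ⟩ + b 1 + b 2 + b 3     ≡⟨ ⟨-,coverage⟩ (a x) ⟨
      ⟨ a x , coverage ⟩                                ≡⟨ ⟨⟩-congʳ (a x) covered ⟩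
      ⟨ a x , (λ _ → + 1) ⟩                             ≡⟨ ⟨-,1⟩≡sum (a x) ⟩
      sum (a x)                                         ≡⟨ degree x ⟩
      + 40                                              ∎
      where
      open ≡-Reasoning
      no-X₀-nbr : ⟨ a x , L 0 ⟩ ≡ + 0
      no-X₀-nbr = begin
        ⟨ a x , L 0 ⟩  ≡⟨ ⟨⟩-congʳ (a x) L₀≡δₓ ⟩
        ⟨ a x , δ x ⟩  ≡⟨ ⟨⟩-comm (a x) (δ x) ⟩
        ⟨ δ x , a x ⟩  ≡⟨ ⟨δ,-⟩ x (a x) ⟩
        a x x          ≡⟨ cong 𝟙 (irrefl X x) ⟩
        + 0            ∎
      drop-zeros : ∀ {p q r s t} → p ≡ + 0 → q ≡ + 0 → p + q + r + s + t ≡ r + s + t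
      drop-zeros {r = r} {s} {t} refl refl = cong (λ u → u + s + t) (ℤ.+-identityˡ r)

    b₁+2b₂+3b₃≡80 : b 1 + + 2 * b 2 + + 3 * b 3 ≡ + 80
    b₁+2b₂+3b₃≡80 = begin
      b 1 + + 2 * b 2 + + 3 * b 3                                  ≡⟨ drop-zero (layer⇒Aχ x∈X₀) ⟨
      + 3 * ⟨ a x , χ ⟩ + b 1 + + 2 * b 2 + + 3 * b 3              ≡⟨ ⟨-,weights⟩ (a x) (+ 3) ⟨
      ⟨ a x , (λ z → + 3 * χ z + L 1 z + + 2 * L 2 z + + 3 * L 3 z) ⟩
        ≡⟨ ⟨⟩-congʳ (a x) (λ z → Aχ≡weights z (covered z)) ⟨
      A (A χ) x                                                    ≡⟨ A² χ x ⟩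
      + 20 * sum χ + (+ 40 - + 20) * χ x + (+ 12 - + 20) * A χ x
        ≡⟨ cong₂ (λ s t → + 20 * s + (+ 40 - + 20) * 𝟙 t + (+ 12 - + 20) * A χ x) sum-χ x∉K ⟩
      + 80 + (+ 12 - + 20) * A χ x                                 ≡⟨ cong (λ s → + 80 + (+ 12 - + 20) * s) (layer⇒Aχ x∈X₀) ⟩
      + 80                                                         ∎
      where
      open ≡-Reasoning
      x∉K : K x ≡ false
      x∉K = layer⇒∉K x∈X₀
      drop-zero : ∀ {p q r s} → p ≡ + 0 → + 3 * p + q + r + s ≡ q + r + s
      drop-zero {q = q} {r} {s} refl = cong (λ u → u + r + s) (ℤ.+-identityˡ q)

    b₃≡2 : b 3 ≡ + 2
    b₃≡2 = trans (⟨𝟙,𝟙⟩≡sum (X₃⊆N[x₀] x∈X₀ |X₂|≡54)) (trans (sum-L 3) (cong +_ |X₃|≡2))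

    b₂≡36 : b 2 ≡ + 36
    b₂≡36 = begin
      b 2                                                            ≡⟨ eliminate (b 1) (b 2) (b 3) ⟩
      (b 1 + + 2 * b 2 + + 3 * b 3) - (b 1 + b 2 + b 3) - + 2 * b 3
        ≡⟨ cong₂ (λ s t → s - t - + 2 * b 3) b₁+2b₂+3b₃≡80 b₁+b₂+b₃≡40 ⟩
      + 80 - + 40 - + 2 * b 3                                        ≡⟨ cong (λ s → + 80 - + 40 - + 2 * s) b₃≡2 ⟩
      + 36                                                           ∎
      where
      open ≡-Reasoning
      eliminate : ∀ p q r → q ≡ (p + + 2 * q + + 3 * r) - (p + q + r) - + 2 * r
      eliminate = solve-∀

    b₁≡2 : b 1 ≡ + 2
    b₁≡2 = begin
      b 1                            ≡⟨ eliminate (b 1) (b 2) (b 3) ⟩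
      (b 1 + b 2 + b 3) - b 2 - b 3  ≡⟨ cong₂ (λ s t → s - t - b 3) b₁+b₂+b₃≡40 b₂≡36 ⟩
      + 40 - + 36 - b 3              ≡⟨ cong (λ s → + 40 - + 36 - s) b₃≡2 ⟩
      + 2                            ∎
      where
      open ≡-Reasoning
      eliminate : ∀ p q r → p ≡ (p + q + r) - q - r
      eliminate = solve-∀

    |Xᵢ∩N[x₀]|≡bᵢ : ∀ i → + count (λ y → layer X K i y ∧ adj X x y) ≡ b i
    |Xᵢ∩N[x₀]|≡bᵢ i = count-∧≡⟨⟩ (layer X K i) (adj X x)

lemma4 : (X : Graph 95) → IsSRG 95 40 12 20 X →
    (K : Fin 95 → Bool) → IsKClique X 4 K →
    ¬ (Σ (Fin 95 → Bool) (λ S → IsKClique X 5 S × K ⊆ S)) →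
    count (layer X K 0) ≡ 1 → count (layer X K 1) ≡ 34 →
    count (layer X K 2) ≡ 54 → count (layer X K 3) ≡ 2 →
    (x₀ : Fin 95) → layer X K 0 x₀ ≡ true →
    (∀ y → layer X K 3 y ≡ true → adj X x₀ y ≡ true) ×
    count (λ y → layer X K 1 y ∧ adj X x₀ y) ≡ 2 ×
    count (λ y → layer X K 2 y ∧ adj X x₀ y) ≡ 36
lemma4 X srg K clique _ |X₀|≡1 |X₁|≡34 |X₂|≡54 |X₃|≡2 x₀ x₀∈X₀ =
  X₃⊆N[x₀] x₀∈X₀ |X₂|≡54 ,
  ℤ.+-injective (trans (|Xᵢ∩N[x₀]|≡bᵢ 1) b₁≡2) ,
  ℤ.+-injective (trans (|Xᵢ∩N[x₀]|≡bᵢ 2) b₂≡36)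
  where
  open FourClique X srg K clique
  open NbrsOfX₀ x₀∈X₀ |X₀|≡1 |X₁|≡34 |X₂|≡54 |X₃|≡2
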